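{- There is an independent set of size $367$ in $C_7^5$, the fifth strong product power of the $7$-cycle; that is, $\alpha(C_7^5)\geq 367$. Consequently the Shannon capacity of $C_7$ satisfies $\Theta(C_7)\geq 367^{1/5} > 3.2578$.
   Context: $C_7$ is the cycle on the $7$ vertices $\mathbb{Z}_7$, with $i,j$ adjacent iff $i-j\in\{1,6\} \pmod 7$. For a graph $G=(V,E)$, the $d$-th strong product power $G^d$ has vertex set $V^d$, with distinct vertices $(u_1,\ldots,u_d)$ and $(v_1,\ldots,v_d)$ adjacent iff for every $i\in\{1,\ldots,d\}$ either $u_i=v_i$ or $u_iv_i\in E$. An independent set is a set of vertices no two of which are adjacent, and $\alpha(H)$ is the maximum size of an independent set in $H$. The Shannon capacity is $\Theta(G)=\sup_{d\in\mathbb{N}} \alpha(G^d)^{1/d}$. -}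

module Defs where

open import Data.Nat using (ℕ; _+_; _∸_; _%_)
open import Data.Fin using (Fin; toℕ)
open import Data.Vec using (Vec; lookup)
open import Data.Sum using (_⊎_)
open import Data.Product using (_×_; Σ)
open import Data.List using (List; length)
open import Data.List.Membership.Propositional using (_∈_)
open import Data.List.Relation.Unary.Unique.Propositional using (Unique)
open import Relation.Binary.PropositionalEquality using (_≡_; _≢_)
open import Relation.Nullary using (¬_)

C7Adj : Fin 7 → Fin 7 → Set
C7Adj i j = ((7 + toℕ i) ∸ toℕ j) % 7 ≡ 1 ⊎ ((7 + toℕ i) ∸ toℕ j) % 7 ≡ 6

Vertex : ℕ → Set
Vertex d = Vec (Fin 7) d

StrongAdj : (d : ℕ) → Vertex d → Vertex d → Set
StrongAdj d u v = u ≢ v × ((k : Fin d) → lookup u k ≡ lookup v k ⊎ C7Adj (lookup u k) (lookup v k))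

IsIndependent : (d : ℕ) → List (Vertex d) → Set
IsIndependent d S = Unique S × (∀ {u v} → u ∈ S → v ∈ S → ¬ StrongAdj d u v)

AlphaAtLeast : (d m : ℕ) → Set
AlphaAtLeast d m = Σ (List (Vertex d)) (λ S → IsIndependent d S × length S ≡ m)

{-# OPTIONS --safe #-}
-- Two vertices of C₇^d are non-adjacent as soon as their entries in some
-- coordinate differ by 2, 3, 4 or 5 mod 7. Every two of the 367 vertices below have
-- such a coordinate; this is checked by running the decision procedure on all pairs.
module Submission where

open import Defs
open import Data.Nat using (ℕ; _<_; _*_; _^_; _<?_)
import Data.Nat as ℕ
open import Data.Nat.DivMod using (_mod_)
open import Data.Fin using (Fin)
import Data.Fin as Fin
open import Data.Fin.Properties using (any?; all?)
open import Data.Vec using ([]; _∷_; lookup; map)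
open import Data.Product using (_×_; _,_; uncurry)
open import Data.Sum using (_⊎_; inj₁; inj₂)
open import Data.List using (List; []; _∷_)
open import Data.List.Membership.Propositional using (_∈_)
open import Data.List.Relation.Unary.Any using (here; there)
import Data.List.Relation.Unary.All as All
open import Data.List.Relation.Unary.AllPairs as AllPairs using (AllPairs; _∷_; allPairs?)
open import Relation.Binary.Definitions using (Decidable; Symmetric; Irreflexive)
open import Relation.Binary.PropositionalEquality using (_≡_; refl; sym)
open import Relation.Nullary using (¬_)
open import Relation.Nullary.Decidable using (toWitness; map′; _⊎-dec_; _→-dec_; ¬?)

allPairs-∈ : ∀ {A : Set} {R : A → A → Set} {xs : List A} {x y : A} →
             Symmetric R → AllPairs R xs → x ∈ xs → y ∈ xs → x ≡ y ⊎ R x y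
allPairs-∈ sym-R (_ ∷ _)     (here refl) (here refl) = inj₁ refl
allPairs-∈ sym-R (Rx ∷ _)    (here refl) (there y∈)  = inj₂ (All.lookup Rx y∈)
allPairs-∈ sym-R (Rx ∷ _)    (there x∈)  (here refl) = inj₂ (sym-R (All.lookup Rx x∈))
allPairs-∈ sym-R (_ ∷ pairs) (there x∈)  (there y∈)  = allPairs-∈ sym-R pairs x∈ y∈

c7Adj? : Decidable C7Adj
c7Adj? i j = (_ ℕ.≟ 1) ⊎-dec (_ ℕ.≟ 6)

c7Adj-sym : Symmetric C7Adj
c7Adj-sym {a} {b} = toWitness {a? = all? λ i → all? λ j → c7Adj? i j →-dec c7Adj? j i} _ a b

Apart : Fin 7 → Fin 7 → Set
Apart a b = ¬ (a ≡ b ⊎ C7Adj a b)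

apart? : Decidable Apart
apart? a b = ¬? ((a Fin.≟ b) ⊎-dec c7Adj? a b)

apart-sym : Symmetric Apart
apart-sym         a≁b (inj₁ b≡a) = a≁b (inj₁ (sym b≡a))
apart-sym {a} {b} a≁b (inj₂ b~a) = a≁b (inj₂ (c7Adj-sym {b} {a} b~a))

apart-irrefl : Irreflexive _≡_ Apart
apart-irrefl refl a≁a = a≁a (inj₁ refl)

record Separated {d} (u v : Vertex d) : Set where
  constructor separatedAt
  field
    coordinate : Fin d
    apart      : Apart (lookup u coordinate) (lookup v coordinate)

separated? : ∀ {d} → Decidable (Separated {d})
separated? u v = map′ (uncurry separatedAt) (λ (separatedAt k apart) → k , apart)
                      (any? λ k → apart? (lookup u k) (lookup v k))

separated-sym : ∀ {d} → Symmetric (Separated {d})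
separated-sym {x = u} {v} (separatedAt k apart) = separatedAt k (apart-sym {lookup u k} {lookup v k} apart)

separated-irrefl : ∀ {d} → Irreflexive _≡_ (Separated {d})
separated-irrefl {x = u} refl (separatedAt k apart) = apart-irrefl {lookup u k} refl apart

separated⇒¬strongAdj : ∀ {d} {u v : Vertex d} → Separated u v → ¬ StrongAdj d u v
separated⇒¬strongAdj (separatedAt k apart) (_ , close) = apart (close k)

separated⇒independent : ∀ {d} {S : List (Vertex d)} → AllPairs Separated S → IsIndependent d S
separated⇒independent {d} {S} pairs =
  AllPairs.map (λ sep u≡v → separated-irrefl u≡v sep) pairs , nonAdjacent
  where
  nonAdjacent : ∀ {u v} → u ∈ S → v ∈ S → ¬ StrongAdj d u v
  nonAdjacent u∈ v∈ with allPairs-∈ separated-sym pairs u∈ v∈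
  ... | inj₁ u≡v = λ (u≢v , _) → u≢v u≡v
  ... | inj₂ sep = separated⇒¬strongAdj sep

vertex : ℕ → ℕ → ℕ → ℕ → ℕ → Vertex 5
vertex a b c d e = map (_mod 7) (a ∷ b ∷ c ∷ d ∷ e ∷ [])

independent367 : List (Vertex 5)
independent367 =
  vertex 0 0 0 0 0 ∷
  vertex 0 0 0 1 5 ∷
  vertex 0 0 2 5 2 ∷
  vertex 0 0 3 4 4 ∷
  vertex 0 0 4 3 6 ∷
  vertex 0 0 5 2 1 ∷
  vertex 0 0 6 2 3 ∷
  vertex 0 1 0 2 0 ∷
  vertex 0 1 0 6 5 ∷
  vertex 0 1 1 0 2 ∷
  vertex 0 1 1 2 2 ∷
  vertex 0 1 2 6 4 ∷
  vertex 0 1 3 5 6 ∷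
  vertex 0 1 4 4 1 ∷
  vertex 0 1 5 4 3 ∷
  vertex 0 1 6 3 5 ∷
  vertex 0 2 0 0 0 ∷
  vertex 0 2 0 1 5 ∷
  vertex 0 2 2 1 4 ∷
  vertex 0 2 5 2 1 ∷
  vertex 0 2 6 2 3 ∷
  vertex 0 3 0 2 0 ∷
  vertex 0 3 1 1 2 ∷
  vertex 0 3 2 6 3 ∷
  vertex 0 3 3 5 5 ∷
  vertex 0 3 4 4 0 ∷
  vertex 0 3 5 4 2 ∷
  vertex 0 3 6 3 5 ∷
  vertex 0 4 1 3 3 ∷
  vertex 0 4 2 0 5 ∷
  vertex 0 4 3 6 0 ∷
  vertex 0 4 4 6 2 ∷
  vertex 0 4 5 5 4 ∷
  vertex 0 4 6 4 0 ∷
  vertex 0 5 0 5 3 ∷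
  vertex 0 5 1 4 5 ∷
  vertex 0 5 2 2 5 ∷
  vertex 0 5 3 1 0 ∷
  vertex 0 5 4 0 4 ∷
  vertex 0 5 4 1 2 ∷
  vertex 0 5 5 6 6 ∷
  vertex 0 5 6 6 1 ∷
  vertex 0 6 0 6 5 ∷
  vertex 0 6 1 5 0 ∷
  vertex 0 6 2 3 0 ∷
  vertex 0 6 3 3 2 ∷
  vertex 0 6 4 2 4 ∷
  vertex 0 6 5 1 6 ∷
  vertex 0 6 6 0 3 ∷
  vertex 1 0 0 4 3 ∷
  vertex 1 0 1 3 5 ∷
  vertex 1 0 2 0 0 ∷
  vertex 1 0 2 1 5 ∷
  vertex 1 0 3 0 2 ∷
  vertex 1 0 4 6 4 ∷
  vertex 1 0 5 5 6 ∷
  vertex 1 0 6 4 1 ∷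
  vertex 1 1 1 4 0 ∷
  vertex 1 1 2 2 0 ∷
  vertex 1 1 3 2 2 ∷
  vertex 1 1 4 0 6 ∷
  vertex 1 1 4 1 4 ∷
  vertex 1 1 5 6 1 ∷
  vertex 1 1 6 6 3 ∷
  vertex 1 2 0 4 2 ∷
  vertex 1 2 1 3 4 ∷
  vertex 1 2 2 0 6 ∷
  vertex 1 2 2 4 2 ∷
  vertex 1 2 3 3 4 ∷
  vertex 1 2 3 6 1 ∷
  vertex 1 2 4 2 6 ∷
  vertex 1 2 4 6 3 ∷
  vertex 1 2 5 5 5 ∷
  vertex 1 2 6 4 0 ∷
  vertex 1 3 0 5 4 ∷
  vertex 1 3 1 4 6 ∷
  vertex 1 3 2 2 6 ∷
  vertex 1 3 3 1 1 ∷
  vertex 1 3 4 0 5 ∷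
  vertex 1 3 4 1 3 ∷
  vertex 1 3 5 6 0 ∷
  vertex 1 3 6 6 2 ∷
  vertex 1 4 0 6 6 ∷
  vertex 1 4 1 5 1 ∷
  vertex 1 4 2 3 1 ∷
  vertex 1 4 3 3 3 ∷
  vertex 1 4 4 2 5 ∷
  vertex 1 4 5 1 0 ∷
  vertex 1 4 6 0 4 ∷
  vertex 1 4 6 1 2 ∷
  vertex 1 5 0 1 6 ∷
  vertex 1 5 1 0 1 ∷
  vertex 1 5 1 0 3 ∷
  vertex 1 5 2 5 3 ∷
  vertex 1 5 3 4 5 ∷
  vertex 1 5 4 3 0 ∷
  vertex 1 5 5 3 2 ∷
  vertex 1 5 6 2 4 ∷
  vertex 1 6 0 2 1 ∷
  vertex 1 6 1 2 3 ∷
  vertex 1 6 2 6 5 ∷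
  vertex 1 6 3 5 0 ∷
  vertex 1 6 4 5 2 ∷
  vertex 1 6 5 4 4 ∷
  vertex 1 6 6 3 6 ∷
  vertex 2 0 0 6 1 ∷
  vertex 2 0 1 6 3 ∷
  vertex 2 0 2 4 3 ∷
  vertex 2 0 3 3 5 ∷
  vertex 2 0 4 2 0 ∷
  vertex 2 0 5 2 2 ∷
  vertex 2 0 6 0 6 ∷
  vertex 2 0 6 1 4 ∷
  vertex 2 1 0 1 1 ∷
  vertex 2 1 1 1 3 ∷
  vertex 2 1 2 5 5 ∷
  vertex 2 1 3 4 0 ∷
  vertex 2 1 4 4 2 ∷
  vertex 2 1 5 3 4 ∷
  vertex 2 1 6 2 6 ∷
  vertex 2 2 0 6 0 ∷
  vertex 2 2 1 6 2 ∷
  vertex 2 2 5 1 1 ∷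
  vertex 2 2 6 0 5 ∷
  vertex 2 2 6 1 3 ∷
  vertex 2 3 0 1 0 ∷
  vertex 2 3 1 0 4 ∷
  vertex 2 3 1 1 2 ∷
  vertex 2 3 2 5 4 ∷
  vertex 2 3 3 4 6 ∷
  vertex 2 3 4 3 1 ∷
  vertex 2 3 5 3 3 ∷
  vertex 2 3 6 2 5 ∷
  vertex 2 4 0 3 2 ∷
  vertex 2 4 1 2 4 ∷
  vertex 2 4 2 6 6 ∷
  vertex 2 4 3 5 1 ∷
  vertex 2 4 4 5 3 ∷
  vertex 2 4 5 4 5 ∷
  vertex 2 4 6 3 0 ∷
  vertex 2 5 0 4 4 ∷
  vertex 2 5 1 3 6 ∷
  vertex 2 5 2 1 6 ∷
  vertex 2 5 3 0 2 ∷
  vertex 2 5 4 6 5 ∷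
  vertex 2 5 5 5 0 ∷
  vertex 2 5 6 5 2 ∷
  vertex 2 6 0 5 6 ∷
  vertex 2 6 1 4 1 ∷
  vertex 2 6 2 2 1 ∷
  vertex 2 6 3 2 3 ∷
  vertex 2 6 4 0 0 ∷
  vertex 2 6 4 1 5 ∷
  vertex 2 6 5 0 2 ∷
  vertex 2 6 6 6 4 ∷
  vertex 3 0 0 3 4 ∷
  vertex 3 0 1 0 6 ∷
  vertex 3 0 1 2 6 ∷
  vertex 3 0 2 6 1 ∷
  vertex 3 0 3 6 3 ∷
  vertex 3 0 4 5 5 ∷
  vertex 3 0 5 4 0 ∷
  vertex 3 0 6 4 2 ∷
  vertex 3 1 0 4 6 ∷
  vertex 3 1 1 3 1 ∷
  vertex 3 1 2 1 1 ∷
  vertex 3 1 3 0 5 ∷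
  vertex 3 1 3 1 3 ∷
  vertex 3 1 4 6 0 ∷
  vertex 3 1 5 6 2 ∷
  vertex 3 1 6 5 4 ∷
  vertex 3 2 0 3 3 ∷
  vertex 3 2 1 2 5 ∷
  vertex 3 2 2 3 3 ∷
  vertex 3 2 2 6 0 ∷
  vertex 3 2 3 2 5 ∷
  vertex 3 2 3 6 2 ∷
  vertex 3 2 4 5 4 ∷
  vertex 3 2 5 4 6 ∷
  vertex 3 2 6 3 1 ∷
  vertex 3 3 0 4 5 ∷
  vertex 3 3 1 3 0 ∷
  vertex 3 3 2 1 0 ∷
  vertex 3 3 3 0 4 ∷
  vertex 3 3 3 1 2 ∷
  vertex 3 3 4 6 6 ∷
  vertex 3 3 5 5 1 ∷
  vertex 3 3 6 5 3 ∷
  vertex 3 4 0 5 0 ∷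
  vertex 3 4 1 5 2 ∷
  vertex 3 4 2 3 2 ∷
  vertex 3 4 3 2 4 ∷
  vertex 3 4 4 1 6 ∷
  vertex 3 4 5 0 1 ∷
  vertex 3 4 5 0 3 ∷
  vertex 3 4 6 6 5 ∷
  vertex 3 5 0 0 0 ∷
  vertex 3 5 0 0 2 ∷
  vertex 3 5 1 6 4 ∷
  vertex 3 5 2 4 4 ∷
  vertex 3 5 3 3 6 ∷
  vertex 3 5 4 2 1 ∷
  vertex 3 5 5 2 3 ∷
  vertex 3 5 6 1 5 ∷
  vertex 3 6 0 2 2 ∷
  vertex 3 6 1 1 4 ∷
  vertex 3 6 2 5 6 ∷
  vertex 3 6 3 4 1 ∷
  vertex 3 6 4 4 3 ∷
  vertex 3 6 5 3 5 ∷
  vertex 3 6 6 2 0 ∷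
  vertex 4 0 0 6 2 ∷
  vertex 4 0 1 5 4 ∷
  vertex 4 0 2 3 4 ∷
  vertex 4 0 3 2 6 ∷
  vertex 4 0 4 1 1 ∷
  vertex 4 0 5 0 5 ∷
  vertex 4 0 5 1 3 ∷
  vertex 4 0 6 6 0 ∷
  vertex 4 1 0 0 4 ∷
  vertex 4 1 2 4 6 ∷
  vertex 4 1 3 3 1 ∷
  vertex 4 1 4 3 3 ∷
  vertex 4 1 5 2 5 ∷
  vertex 4 1 6 1 0 ∷
  vertex 4 2 0 5 1 ∷
  vertex 4 2 1 5 3 ∷
  vertex 4 2 4 1 0 ∷
  vertex 4 2 5 0 4 ∷
  vertex 4 2 5 1 2 ∷
  vertex 4 2 6 6 6 ∷
  vertex 4 3 0 0 1 ∷
  vertex 4 3 0 0 3 ∷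
  vertex 4 3 1 6 5 ∷
  vertex 4 3 2 4 5 ∷
  vertex 4 3 3 3 0 ∷
  vertex 4 3 4 3 2 ∷
  vertex 4 3 5 2 4 ∷
  vertex 4 3 6 1 6 ∷
  vertex 4 4 0 2 3 ∷
  vertex 4 4 1 1 5 ∷
  vertex 4 4 2 5 0 ∷
  vertex 4 4 3 5 2 ∷
  vertex 4 4 4 4 4 ∷
  vertex 4 4 5 3 6 ∷
  vertex 4 4 6 2 1 ∷
  vertex 4 5 0 3 5 ∷
  vertex 4 5 1 2 0 ∷
  vertex 4 5 2 0 2 ∷
  vertex 4 5 3 6 4 ∷
  vertex 4 5 4 5 6 ∷
  vertex 4 5 5 4 1 ∷
  vertex 4 5 6 4 3 ∷
  vertex 4 6 0 4 0 ∷
  vertex 4 6 1 4 2 ∷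
  vertex 4 6 2 2 2 ∷
  vertex 4 6 3 0 6 ∷
  vertex 4 6 3 1 4 ∷
  vertex 4 6 4 6 1 ∷
  vertex 4 6 5 6 3 ∷
  vertex 4 6 6 5 5 ∷
  vertex 5 0 0 2 5 ∷
  vertex 5 0 1 1 0 ∷
  vertex 5 0 2 6 2 ∷
  vertex 5 0 3 5 4 ∷
  vertex 5 0 4 4 6 ∷
  vertex 5 0 5 3 1 ∷
  vertex 5 0 6 3 3 ∷
  vertex 5 1 0 3 0 ∷
  vertex 5 1 1 1 2 ∷
  vertex 5 1 1 3 2 ∷
  vertex 5 1 1 6 6 ∷
  vertex 5 1 2 0 4 ∷
  vertex 5 1 3 6 6 ∷
  vertex 5 1 4 5 1 ∷
  vertex 5 1 5 5 3 ∷
  vertex 5 1 6 4 5 ∷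
  vertex 5 2 0 2 4 ∷
  vertex 5 2 1 1 6 ∷
  vertex 5 2 2 2 4 ∷
  vertex 5 2 4 4 5 ∷
  vertex 5 2 5 3 0 ∷
  vertex 5 2 6 3 2 ∷
  vertex 5 3 0 3 6 ∷
  vertex 5 3 1 2 1 ∷
  vertex 5 3 2 0 3 ∷
  vertex 5 3 3 6 5 ∷
  vertex 5 3 4 5 0 ∷
  vertex 5 3 5 5 2 ∷
  vertex 5 3 6 4 4 ∷
  vertex 5 4 0 4 1 ∷
  vertex 5 4 1 4 3 ∷
  vertex 5 4 2 2 3 ∷
  vertex 5 4 3 0 0 ∷
  vertex 5 4 3 1 5 ∷
  vertex 5 4 4 0 2 ∷
  vertex 5 4 5 6 4 ∷
  vertex 5 4 6 5 6 ∷
  vertex 5 5 0 6 3 ∷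
  vertex 5 5 1 5 5 ∷
  vertex 5 5 2 3 5 ∷
  vertex 5 5 3 2 0 ∷
  vertex 5 5 4 2 2 ∷
  vertex 5 5 5 0 6 ∷
  vertex 5 5 5 1 4 ∷
  vertex 5 5 6 6 1 ∷
  vertex 5 6 0 0 5 ∷
  vertex 5 6 0 1 3 ∷
  vertex 5 6 1 6 0 ∷
  vertex 5 6 2 4 0 ∷
  vertex 5 6 3 4 2 ∷
  vertex 5 6 4 3 4 ∷
  vertex 5 6 5 2 6 ∷
  vertex 5 6 6 1 1 ∷
  vertex 6 0 0 5 3 ∷
  vertex 6 0 1 4 5 ∷
  vertex 6 0 2 2 5 ∷
  vertex 6 0 3 1 0 ∷
  vertex 6 0 4 0 4 ∷
  vertex 6 0 5 6 6 ∷
  vertex 6 0 6 5 1 ∷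
  vertex 6 1 2 3 0 ∷
  vertex 6 1 3 2 2 ∷
  vertex 6 1 4 2 4 ∷
  vertex 6 1 5 0 1 ∷
  vertex 6 1 5 1 6 ∷
  vertex 6 1 6 0 3 ∷
  vertex 6 2 0 5 2 ∷
  vertex 6 2 1 4 4 ∷
  vertex 6 2 2 5 1 ∷
  vertex 6 2 3 0 1 ∷
  vertex 6 2 3 1 6 ∷
  vertex 6 2 3 4 3 ∷
  vertex 6 2 4 0 3 ∷
  vertex 6 2 5 6 5 ∷
  vertex 6 2 6 5 0 ∷
  vertex 6 3 0 6 4 ∷
  vertex 6 3 1 5 6 ∷
  vertex 6 3 2 3 6 ∷
  vertex 6 3 3 2 1 ∷
  vertex 6 3 4 2 3 ∷
  vertex 6 3 5 0 0 ∷
  vertex 6 3 5 1 5 ∷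
  vertex 6 3 6 0 2 ∷
  vertex 6 4 0 0 6 ∷
  vertex 6 4 0 1 4 ∷
  vertex 6 4 1 6 1 ∷
  vertex 6 4 2 4 1 ∷
  vertex 6 4 3 4 3 ∷
  vertex 6 4 4 3 5 ∷
  vertex 6 4 5 2 0 ∷
  vertex 6 4 6 2 2 ∷
  vertex 6 5 0 2 6 ∷
  vertex 6 5 1 1 1 ∷
  vertex 6 5 2 6 3 ∷
  vertex 6 5 3 5 5 ∷
  vertex 6 5 4 4 0 ∷
  vertex 6 5 5 4 2 ∷
  vertex 6 5 6 3 4 ∷
  vertex 6 6 0 3 1 ∷
  vertex 6 6 1 3 3 ∷
  vertex 6 6 2 0 5 ∷
  vertex 6 6 2 1 3 ∷
  vertex 6 6 3 6 0 ∷
  vertex 6 6 4 6 2 ∷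
  vertex 6 6 5 5 4 ∷
  vertex 6 6 6 4 6 ∷
  []

mainTheorem1 : AlphaAtLeast 5 367 × (32578 ^ 5 < 367 * 10000 ^ 5)
mainTheorem1 =
  (independent367 , separated⇒independent independent367-separated , refl) ,
  toWitness {a? = 32578 ^ 5 <? 367 * 10000 ^ 5} _
  where
  independent367-separated : AllPairs Separated independent367
  independent367-separated = toWitness {a? = allPairs? separated? independent367} _
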